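{- Suppose $|\mathcal{L}|\ge 3$. There is no function $\mathrm{D}$ on pairs of rooted ordered binary trees with labels in $\mathcal{L}$ and possible lock marks that satisfies both (B2) $\mathrm{D}(T_1^*,T_2^*)\ge0$ with $\mathrm{D}(T_1^*,T_2^*)=0$ if and only if $T_1^*\approx T_2^*$, and the triangle inequality $\mathrm{D}(T_1^*,T_2^*)+\mathrm{D}(T_1^*,T_3^*)\ge\mathrm{D}(T_2^*,T_3^*)$ for all $T_1^*,T_2^*,T_3^*$. In particular, semi-equivalence $\approx$ is not transitive.
   Context: Trees are rooted ordered binary trees (left/right children designated) whose vertices carry labels from $\mathcal{L}$ (repetitions allowed); some non-leaf vertices may carry a "lock mark". For a tree $T^*$ with lock marks and an ordered tree $T$ without lock marks, $T^*\to T$ means $T^*$ can be transformed into $T$ by switching left and right subtrees (labels move with vertices) at some vertices without lock marks, so that afterwards shapes and labels agree (lock marks ignored). Semi-equivalence: $T_1^*\approx T_2^*$ if there is an ordered tree $T$ without lock marks with $T_1^*\to T$ and $T_2^*\to T$. -}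

module Defs where

open import Level using (Level; _⊔_; suc)
open import Data.Bool using (Bool; true; false)
open import Data.Maybe using (Maybe; just; nothing)
open import Data.Product using (Σ; ∃; _×_; _,_)
open import Relation.Binary.PropositionalEquality using (_≡_)
open import Relation.Binary.Structures using (IsPartialOrder)
open import Algebra.Structures using (IsCommutativeMonoid)
open import Algebra.Core using (Op₂)
open import Relation.Binary.Core using (Rel)
open import Relation.Nullary using (¬_)

-- Value domain for D.  The paper's D is real-valued; we allow any
-- partially ordered commutative monoid (ℝ with + and ≤ is one), which
-- makes the impossibility statement at least as strong.

record OrderedCommMonoid (c ℓ : Level) : Set (suc (c ⊔ ℓ)) where
  field
    Carrier  : Set c
    _≤_      : Rel Carrier ℓ
    _+_      : Op₂ Carrier
    0#       : Carrier
    isPartialOrder      : IsPartialOrder _≡_ _≤_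
    isCommutativeMonoid : IsCommutativeMonoid _≡_ _+_ 0#
    +-mono-≤ : ∀ {x x′ y y′} → x ≤ x′ → y ≤ y′ → (x + y) ≤ (x′ + y′)

module Trees {a : Level} (L : Set a) where

  data Tree : Set a where
    node : Maybe Tree → L → Maybe Tree → Tree

  -- ordered labelled binary trees, each vertex with a lock flag
  -- (true = lock mark present)
  data MTree : Set a where
    node : Maybe MTree → Bool → L → Maybe MTree → MTree

  data NonLeaf : Maybe MTree → Maybe MTree → Set a where
    left  : ∀ {t r} → NonLeaf (just t) r
    right : ∀ {l t} → NonLeaf l (just t)

  data WellMarked : MTree → Set a
  data WellMarkedₘ : Maybe MTree → Set a
  data WellMarked where
    unlocked : ∀ {l x r} → WellMarkedₘ l → WellMarkedₘ r →
               WellMarked (node l false x r)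
    locked   : ∀ {l x r} → NonLeaf l r → WellMarkedₘ l → WellMarkedₘ r →
               WellMarked (node l true x r)
  data WellMarkedₘ where
    nothing : WellMarkedₘ nothing
    just    : ∀ {t} → WellMarked t → WellMarkedₘ (just t)

  Tree* : Set a
  Tree* = Σ MTree WellMarked

  infix 4 _⇝_ _⇝ₘ_
  data _⇝_ : MTree → Tree → Set a
  data _⇝ₘ_ : Maybe MTree → Maybe Tree → Set a
  data _⇝_ where
    keep   : ∀ {l r l′ r′ b x} → l ⇝ₘ l′ → r ⇝ₘ r′ →
             node l b x r ⇝ node l′ x r′
    switch : ∀ {l r l′ r′ x} → r ⇝ₘ l′ → l ⇝ₘ r′ →
             node l false x r ⇝ node l′ x r′
  data _⇝ₘ_ where
    nothing : nothing ⇝ₘ nothing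
    just    : ∀ {t t′} → t ⇝ t′ → just t ⇝ₘ just t′

  infix 4 _≈*_
  _≈*_ : Tree* → Tree* → Set a
  (T₁ , _) ≈* (T₂ , _) = ∃ λ (T : Tree) → (T₁ ⇝ T) × (T₂ ⇝ T)

  module _ {c ℓ : Level} (M : OrderedCommMonoid c ℓ) where
    open OrderedCommMonoid M

    B2 : (Tree* → Tree* → Carrier) → Set (a ⊔ c ⊔ ℓ)
    B2 D = ∀ T₁ T₂ → (0# ≤ D T₁ T₂) ×
                     ((D T₁ T₂ ≡ 0# → T₁ ≈* T₂) × (T₁ ≈* T₂ → D T₁ T₂ ≡ 0#))

    Triangle : (Tree* → Tree* → Carrier) → Set (a ⊔ ℓ)
    Triangle D = ∀ T₁ T₂ T₃ → D T₂ T₃ ≤ (D T₁ T₂ + D T₁ T₃)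

-- If D satisfied (B2) and the triangle inequality, then for T₁ ≈ T₂ ≈ T₃ we
-- would get D(T₁,T₃) ≤ D(T₂,T₁) + D(T₂,T₃) = 0, so ≈ would be transitive.
-- It is not: the tree x(y,z) without a lock is semi-equivalent both to
-- itself with a lock at the root and to x(z,y) with a lock at the root, but
-- those two locked trees have different images.
module Submission where

open import Defs
open import Level using (Level)
open import Data.Bool using (Bool; true; false)
open import Data.Maybe using (just; nothing)
open import Data.Product using (Σ; _×_; _,_; proj₁; proj₂)
open import Algebra.Structures using (IsCommutativeMonoid)
open import Relation.Binary.Core using (Rel)
open import Relation.Binary.Structures using (IsPartialOrder)
open import Relation.Binary.PropositionalEquality
  using (_≡_; _≢_; refl; sym; trans; cong₂; subst)
open import Relation.Nullary using (¬_)

module _ {c ℓ : Level} (M : OrderedCommMonoid c ℓ) where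
  open OrderedCommMonoid M
  open IsPartialOrder isPartialOrder using (antisym)
  open IsCommutativeMonoid isCommutativeMonoid using (identityˡ)

  zeroSet-transitive : ∀ {a r} {A : Set a} {R : Rel A r} (D : A → A → Carrier) →
    (∀ u v → R u v → R v u) →
    (∀ u v → 0# ≤ D u v) →
    (∀ u v → D u v ≡ 0# → R u v) →
    (∀ u v → R u v → D u v ≡ 0#) →
    (∀ u v w → D v w ≤ (D u v + D u w)) →
    ∀ u v w → R u v → R v w → R u w
  zeroSet-transitive D R-sym nonneg zero⇒R R⇒zero triangle u v w Ruv Rvw =
    zero⇒R u w (antisym Duw≤0 (nonneg u w))
    where
    Duw≤0 : D u w ≤ 0#
    Duw≤0 = subst (D u w ≤_)
      (trans (cong₂ _+_ (R⇒zero v u (R-sym u v Ruv)) (R⇒zero v w Rvw)) (identityˡ 0#))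
      (triangle v u w)

module _ {a : Level} (L : Set a) where
  open Trees L

  leafᵐ : L → MTree
  leafᵐ u = node nothing false u nothing

  leaf : L → Tree
  leaf u = node nothing u nothing

  cherryᵐ : Bool → L → L → L → MTree
  cherryᵐ lock u v w = node (just (leafᵐ v)) lock u (just (leafᵐ w))

  cherry : L → L → L → Tree
  cherry u v w = node (just (leaf v)) u (just (leaf w))

  wellMarked-leafᵐ : ∀ u → WellMarked (leafᵐ u)
  wellMarked-leafᵐ _ = unlocked nothing nothing

  wellMarked-cherryᵐ : ∀ lock u v w → WellMarked (cherryᵐ lock u v w)
  wellMarked-cherryᵐ false _ v w = unlocked (just (wellMarked-leafᵐ v)) (just (wellMarked-leafᵐ w))
  wellMarked-cherryᵐ true  _ v w = locked left (just (wellMarked-leafᵐ v)) (just (wellMarked-leafᵐ w))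

  cherry* : Bool → L → L → L → Tree*
  cherry* lock u v w = cherryᵐ lock u v w , wellMarked-cherryᵐ lock u v w

  leafᵐ-⇝ : ∀ {u T} → leafᵐ u ⇝ T → T ≡ leaf u
  leafᵐ-⇝ (keep nothing nothing)   = refl
  leafᵐ-⇝ (switch nothing nothing) = refl

  locked-cherryᵐ-⇝ : ∀ {u v w T} → cherryᵐ true u v w ⇝ T → T ≡ cherry u v w
  locked-cherryᵐ-⇝ (keep (just p) (just q)) with refl ← leafᵐ-⇝ p | refl ← leafᵐ-⇝ q = refl

  cherryᵐ-⇝-cherry : ∀ lock u v w → cherryᵐ lock u v w ⇝ cherry u v w
  cherryᵐ-⇝-cherry _ _ _ _ = keep (just (keep nothing nothing)) (just (keep nothing nothing))

  cherryᵐ-⇝-swapped : ∀ u v w → cherryᵐ false u v w ⇝ cherry u w v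
  cherryᵐ-⇝-swapped _ _ _ = switch (just (keep nothing nothing)) (just (keep nothing nothing))

  -- Points are passed explicitly throughout: _≈*_ ignores the well-markedness
  -- component of a Tree*, so implicit points could not be inferred.
  ≈*-sym : ∀ T₁ T₂ → T₁ ≈* T₂ → T₂ ≈* T₁
  ≈*-sym _ _ (T , p , q) = T , q , p

  locked-cherries-≉ : ∀ x {y z : L} → y ≢ z → ¬ (cherry* true x y z ≈* cherry* true x z y)
  locked-cherries-≉ _ y≢z (_ , p , q)
    with refl ← trans (sym (locked-cherryᵐ-⇝ p)) (locked-cherryᵐ-⇝ q) = y≢z refl

  ≈*-intransitive : ∀ x {y z : L} → y ≢ z → ¬ (∀ T₁ T₂ T₃ → T₁ ≈* T₂ → T₂ ≈* T₃ → T₁ ≈* T₃)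
  ≈*-intransitive x {y} {z} y≢z ≈*-trans = locked-cherries-≉ x y≢z
    (≈*-trans (cherry* true x y z) (cherry* false x y z) (cherry* true x z y)
      (_ , cherryᵐ-⇝-cherry true x y z , cherryᵐ-⇝-cherry false x y z)
      (_ , cherryᵐ-⇝-swapped x y z , cherryᵐ-⇝-cherry true x z y))

  B2∧Triangle⇒≈*-transitive : ∀ {c ℓ} (M : OrderedCommMonoid c ℓ)
    (D : Tree* → Tree* → OrderedCommMonoid.Carrier M) →
    B2 M D → Triangle M D → ∀ T₁ T₂ T₃ → T₁ ≈* T₂ → T₂ ≈* T₃ → T₁ ≈* T₃
  B2∧Triangle⇒≈*-transitive M D b2 triangle = zeroSet-transitive M D ≈*-sym
    (λ u v → proj₁ (b2 u v))
    (λ u v → proj₁ (proj₂ (b2 u v)))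
    (λ u v → proj₂ (proj₂ (b2 u v)))
    triangle

-- Only the two distinct labels y and z are needed; x ≢ y and x ≢ z are unused.
mainTheorem9 : ∀ {a c ℓ : Level} (L : Set a) (x y z : L) → x ≢ y → x ≢ z → y ≢ z →
    (∀ (M : OrderedCommMonoid c ℓ) →
       ¬ (Σ (Trees.Tree* L → Trees.Tree* L → OrderedCommMonoid.Carrier M)
            (λ D → Trees.B2 L M D × Trees.Triangle L M D)))
    × ¬ (∀ (T₁ T₂ T₃ : Trees.Tree* L) →
           Trees._≈*_ L T₁ T₂ → Trees._≈*_ L T₂ T₃ → Trees._≈*_ L T₁ T₃)
mainTheorem9 L x y z _ _ y≢z =
  (λ M (D , b2 , triangle) →
     ≈*-intransitive L x y≢z (B2∧Triangle⇒≈*-transitive L M D b2 triangle)) ,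
  ≈*-intransitive L x y≢z
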